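{- For every integer $m\ge 2$, the set $\mathrm{Shed}(P_m)$ is not a dominating set of $P_m$ (where $P_m$ is vertex decomposable).
   Context: For $m\ge2$, $P_m$ is the graph with vertex set $X\cup Y\cup Z$, $X=\{x_1,\ldots,x_{2m}\}$, $Y=\{y_1,y_2\}$, $Z=\{z_1,z_2,z_3\}$, whose edges are exactly: (i) the induced subgraph on $X$ is the complete $m$-partite graph $K_{2,\ldots,2}$ whose complement is the matching $\{x_{2i-1},x_{2i}\}$, $1\le i\le m$; (ii) $y_1$ is adjacent to $z_1$ and to each $x_{2i-1}$, $1\le i\le m$; (iii) $y_2$ is adjacent to $z_2$ and to each $x_{2i}$, $1\le i\le m$; (iv) $Z$ induces a triangle $K_3$. For a graph $G=(V,E)$ and $x\in V$, $G\setminus x$ is the graph obtained by deleting $x$ and its incident edges; $N[x]$ is $x$ together with its neighbours, and $G\setminus N[x]$ is obtained by deleting all vertices of $N[x]$ and their incident edges. A graph is well-covered if all its maximal independent sets have the same cardinality. A graph $G$ is vertex decomposable if $G$ is well-covered and either (i) $G$ has no edges (possibly no vertices), or (ii) there is a vertex $x$ such that both $G\setminus x$ and $G\setminus N[x]$ are vertex decomposable. For a vertex decomposable graph $G$, $\mathrm{Shed}(G)$ is the set of vertices $x$ such that $G\setminus x$ and $G\setminus N[x]$ are both vertex decomposable. A set $D\subseteq V$ is dominating if every vertex of $V\setminus D$ is adjacent to a vertex of $D$. -}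

module Defs where

open import Data.Bool using (Bool; true; false; not; _∧_; _∨_)
open import Data.Nat using (ℕ; zero; suc; _+_; _*_; _≡ᵇ_; _<ᵇ_; _/_; _%_; _≤_)
open import Data.Fin using (Fin; toℕ; _≟_)
open import Data.Fin.Subset using (Subset; _∈_; _∉_; _⊆_; ∣_∣; _∩_; ∁; _-_; ⊤)
open import Data.Vec using (tabulate)
open import Data.Product using (Σ; _×_; ∃; ∃-syntax)
open import Relation.Binary.PropositionalEquality using (_≡_; refl; cong)
open import Relation.Nullary using (¬_; does)

-- All graphs arising in the definition of vertex decomposability of G
-- (G, G \ x, G \ N[x], ...) are induced subgraphs of G, so we work with
-- an ambient graph and a vertex subset W (the induced subgraph G[W]).

record Graph (n : ℕ) : Set where
  field
    adj   : Fin n → Fin n → Bool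
    sym   : ∀ u v → adj u v ≡ adj v u
    irrefl : ∀ v → adj v v ≡ false
open Graph public

module _ {n : ℕ} (G : Graph n) where

  Independent : Subset n → Subset n → Set
  Independent W I = I ⊆ W × (∀ u v → u ∈ I → v ∈ I → adj G u v ≡ false)

  MaximalIndependent : Subset n → Subset n → Set
  MaximalIndependent W I =
    Independent W I × (∀ J → Independent W J → I ⊆ J → J ⊆ I)

  WellCovered : Subset n → Set
  WellCovered W = ∀ I J → MaximalIndependent W I → MaximalIndependent W J → ∣ I ∣ ≡ ∣ J ∣

  NoEdges : Subset n → Set
  NoEdges W = ∀ u v → u ∈ W → v ∈ W → adj G u v ≡ false

  closedNbhd : Fin n → Subset n
  closedNbhd x = tabulate (λ y → does (y ≟ x) ∨ adj G x y)

  delete : Subset n → Fin n → Subset n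
  delete W x = W - x

  deleteN : Subset n → Fin n → Subset n
  deleteN W x = W ∩ ∁ (closedNbhd x)

  data VertexDecomposable (W : Subset n) : Set where
    vd-noEdges : WellCovered W → NoEdges W → VertexDecomposable W
    vd-shed    : WellCovered W → (x : Fin n) → x ∈ W
               → VertexDecomposable (delete W x)
               → VertexDecomposable (deleteN W x)
               → VertexDecomposable W

  Shed : Subset n → Fin n → Set
  Shed W x = x ∈ W × VertexDecomposable (delete W x) × VertexDecomposable (deleteN W x)

  Dominating : Subset n → (Fin n → Set) → Set
  Dominating W D = ∀ v → v ∈ W → ¬ D v → ∃[ u ] (D u × u ∈ W × adj G u v ≡ true)

-- The graph P_m on 2m+5 vertices, indexed by Fin (2m+5):
--   index k < 2m  : x_{k+1}   (so x_{2i-1} has even index 2i-2, x_{2i} odd index)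
--   index 2m      : y₁ ;  2m+1 : y₂ ;  2m+2, 2m+3, 2m+4 : z₁, z₂, z₃

data Kind : Set where
  xv : ℕ → Kind
  y₁ y₂ z₁ z₂ z₃ other : Kind

kind : ℕ → ℕ → Kind
kind m k with k <ᵇ (2 * m)
... | true = xv k
... | false with k ≡ᵇ 2 * m
... | true = y₁
... | false with k ≡ᵇ 2 * m + 1
... | true = y₂
... | false with k ≡ᵇ 2 * m + 2
... | true = z₁
... | false with k ≡ᵇ 2 * m + 3
... | true = z₂
... | false with k ≡ᵇ 2 * m + 4
... | true = z₃
... | false = other

evenᵇ : ℕ → Bool
evenᵇ a = a % 2 ≡ᵇ 0

adjK : Kind → Kind → Bool
adjK (xv a) (xv b) = not (a / 2 ≡ᵇ b / 2)   -- complement of X is the matching {x_{2i-1}, x_{2i}}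
adjK y₁ (xv a) = evenᵇ a
adjK (xv a) y₁ = evenᵇ a
adjK y₂ (xv a) = not (evenᵇ a)
adjK (xv a) y₂ = not (evenᵇ a)
adjK y₁ z₁ = true
adjK z₁ y₁ = true
adjK y₂ z₂ = true
adjK z₂ y₂ = true
adjK z₁ z₂ = true
adjK z₂ z₁ = true
adjK z₁ z₃ = true
adjK z₃ z₁ = true
adjK z₂ z₃ = true
adjK z₃ z₂ = true
adjK _ _ = false

P-adj : (m : ℕ) → Fin (2 * m + 5) → Fin (2 * m + 5) → Bool
P-adj m u v = adjK (kind m (toℕ u)) (kind m (toℕ v))

private
  ≡ᵇ-sym : ∀ a b → (a ≡ᵇ b) ≡ (b ≡ᵇ a)
  ≡ᵇ-sym zero zero = refl
  ≡ᵇ-sym zero (suc b) = refl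
  ≡ᵇ-sym (suc a) zero = refl
  ≡ᵇ-sym (suc a) (suc b) = ≡ᵇ-sym a b

  ≡ᵇ-refl : ∀ a → (a ≡ᵇ a) ≡ true
  ≡ᵇ-refl zero = refl
  ≡ᵇ-refl (suc a) = ≡ᵇ-refl a

  adjK-sym : ∀ p q → adjK p q ≡ adjK q p
  adjK-sym (xv a) (xv b) = cong not (≡ᵇ-sym (a / 2) (b / 2))
  adjK-sym (xv a) y₁ = refl
  adjK-sym (xv a) y₂ = refl
  adjK-sym (xv a) z₁ = refl
  adjK-sym (xv a) z₂ = refl
  adjK-sym (xv a) z₃ = refl
  adjK-sym (xv a) other = refl
  adjK-sym y₁ (xv b) = refl
  adjK-sym y₁ y₁ = refl
  adjK-sym y₁ y₂ = refl
  adjK-sym y₁ z₁ = refl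
  adjK-sym y₁ z₂ = refl
  adjK-sym y₁ z₃ = refl
  adjK-sym y₁ other = refl
  adjK-sym y₂ (xv b) = refl
  adjK-sym y₂ y₁ = refl
  adjK-sym y₂ y₂ = refl
  adjK-sym y₂ z₁ = refl
  adjK-sym y₂ z₂ = refl
  adjK-sym y₂ z₃ = refl
  adjK-sym y₂ other = refl
  adjK-sym z₁ (xv b) = refl
  adjK-sym z₁ y₁ = refl
  adjK-sym z₁ y₂ = refl
  adjK-sym z₁ z₁ = refl
  adjK-sym z₁ z₂ = refl
  adjK-sym z₁ z₃ = refl
  adjK-sym z₁ other = refl
  adjK-sym z₂ (xv b) = refl
  adjK-sym z₂ y₁ = refl
  adjK-sym z₂ y₂ = refl
  adjK-sym z₂ z₁ = refl
  adjK-sym z₂ z₂ = refl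
  adjK-sym z₂ z₃ = refl
  adjK-sym z₂ other = refl
  adjK-sym z₃ (xv b) = refl
  adjK-sym z₃ y₁ = refl
  adjK-sym z₃ y₂ = refl
  adjK-sym z₃ z₁ = refl
  adjK-sym z₃ z₂ = refl
  adjK-sym z₃ z₃ = refl
  adjK-sym z₃ other = refl
  adjK-sym other (xv b) = refl
  adjK-sym other y₁ = refl
  adjK-sym other y₂ = refl
  adjK-sym other z₁ = refl
  adjK-sym other z₂ = refl
  adjK-sym other z₃ = refl
  adjK-sym other other = refl

  adjK-irrefl : ∀ p → adjK p p ≡ false
  adjK-irrefl (xv a) = cong not (≡ᵇ-refl (a / 2))
  adjK-irrefl y₁ = refl
  adjK-irrefl y₂ = refl
  adjK-irrefl z₁ = refl
  adjK-irrefl z₂ = refl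
  adjK-irrefl z₃ = refl
  adjK-irrefl other = refl

-- The graph P_m (meaningful for m ≥ 2; vertex set Fin (2m+5))
P : (m : ℕ) → Graph (2 * m + 5)
P m = record
  { adj = P-adj m
  ; sym = λ u v → adjK-sym (kind m (toℕ u)) (kind m (toℕ v))
  ; irrefl = λ v → adjK-irrefl (kind m (toℕ v))
  }

-- P_m is covered by the cliques X₁ ∪ {y₁}, X₂ ∪ {y₂} and {z₁, z₂, z₃}, where X₁ = {x_{2i-1}} and
-- X₂ = {x_{2i}}, and a maximal independent set meets each of them, so P_m is well-covered with
-- independence number 3.  If N[v] ⊆ N[w] for a neighbour v of w, then G ∖ w and G ∖ N[w] inherit
-- well-coveredness from G, so w is a shedding vertex as soon as both graphs are vertex decomposable.
-- This lets us shed z₂ and then z₁ (both dominate z₃).  Each of the three graphs left contains some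
-- y_s but neither z₁ nor z₂, and there the vertices of X_s are shed one at a time (each dominates
-- y_s); every G ∖ N[x] met on the way, and the graph left at the end, is a clique plus isolated
-- vertices.
--
-- Shed(P_m) does not dominate x₁, whose closed neighbourhood is (X ∖ {x₂}) ∪ {y₁}.  Call x_{2i-1}
-- and x_{2i} partners.  If x ∈ X has partner x̄, any W with X ∖ {x} ⊆ W ⊆ N[x̄] has the maximal
-- independent sets {x̄} and {x_{2k-1}, x_{2k}} for another pair, so it is not well-covered; taking
-- W = (P_m ∖ x) ∖ N[z] for the z adjacent to the y adjacent to x shows that P_m ∖ x is not
-- well-covered.  P_m ∖ y₁ contains X, misses y₁, and contains z₂ if it contains y₂.  A shedding step
-- from such a graph either deletes some x ∈ X, which leaves a graph that is not well-covered by the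
-- same argument, or leads to another graph of this kind; so none of them is vertex decomposable.

module Submission where

open import Defs hiding (sym; z₃)
open import Data.Bool using (Bool; true; false; not; T; _∨_)
import Data.Bool.Properties as Bool
open import Data.Empty using (⊥)
open import Data.Fin using (Fin; zero; suc; toℕ; fromℕ<; _≟_)
open import Data.Fin.Properties using (any?; toℕ<n; toℕ-fromℕ<; toℕ-injective)
open import Data.Fin.Subset using (Subset; _∈_; _∉_; _⊆_; _∪_; _─_; _-_; ⁅_⁆; ∣_∣; ⊤; inside; outside)
open import Data.Fin.Subset.Properties
open import Data.List using ([]; _∷_; allFin)
open import Data.List.Relation.Unary.Any using (here; there)
import Data.List.Membership.Propositional as List
open import Data.List.Membership.Propositional.Properties using (∈-allFin)
open import Data.Nat using (ℕ; zero; suc; _+_; _*_; _∸_; _<_; _≤_; z≤n; s≤s; _<ᵇ_; _≡ᵇ_; _/_; _%_)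
open import Data.Nat.DivMod
  using (m≡m%n+[m/n]*n; m%n<n; m*n%n≡0; [m+kn]%n≡m%n; m*n/n≡m; +-distrib-/; m<n*o⇒m/o<n)
import Data.Nat.Properties as ℕ
open import Data.Product using (_×_; _,_; proj₁; proj₂; ∃-syntax)
open import Data.Sum using (_⊎_; inj₁; inj₂)
import Data.Sum as Sum
open import Data.Unit using (tt) renaming (⊤ to Unit)
open import Data.Vec using (_∷_) renaming (here to vhere; there to vthere)
open import Data.Vec.Properties using (lookup∘tabulate; []=⇒lookup; lookup⇒[]=)
open import Function using (_∘_; case_of_)
open import Relation.Binary.PropositionalEquality
  using (_≡_; _≢_; refl; sym; trans; cong; subst; subst₂; module ≡-Reasoning)
open import Relation.Nullary using (¬_; Dec; yes; no; does; contradiction)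
import Relation.Nullary.Decidable as Dec
open import Relation.Nullary.Decidable using (_×-dec_; _→-dec_; ¬?; decidable-stable; dec-true; dec-false)
open import Relation.Unary using (Decidable)

x∈p─q⇒x∉q : ∀ {n} {x : Fin n} {p q} → x ∈ p ─ q → x ∉ q
x∈p─q⇒x∉q {p = inside ∷ p} {outside ∷ q} vhere = λ ()
x∈p─q⇒x∉q {p = _ ∷ p} {_ ∷ q} (vthere x∈p─q) (vthere x∈q) = x∈p─q⇒x∉q x∈p─q x∈q

∣p∪⁅x⁆∣≡1+∣p∣ : ∀ {n} {x : Fin n} {p} → x ∉ p → ∣ p ∪ ⁅ x ⁆ ∣ ≡ suc ∣ p ∣
∣p∪⁅x⁆∣≡1+∣p∣ {x = zero} {outside ∷ p} x∉p rewrite ∪-identityʳ p = refl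
∣p∪⁅x⁆∣≡1+∣p∣ {x = zero} {inside ∷ p} x∉p = contradiction vhere x∉p
∣p∪⁅x⁆∣≡1+∣p∣ {x = suc x} {outside ∷ p} x∉p = ∣p∪⁅x⁆∣≡1+∣p∣ (x∉p ∘ vthere)
∣p∪⁅x⁆∣≡1+∣p∣ {x = suc x} {inside ∷ p} x∉p = cong suc (∣p∪⁅x⁆∣≡1+∣p∣ (x∉p ∘ vthere))

x∈⁅a⁆∪⁅b⁆⁻ : ∀ {n} {x a b : Fin n} → x ∈ ⁅ a ⁆ ∪ ⁅ b ⁆ → x ≡ a ⊎ x ≡ b
x∈⁅a⁆∪⁅b⁆⁻ {a = a} {b} x∈ = Sum.map (x∈⁅y⁆⇒x≡y a) (x∈⁅y⁆⇒x≡y b) (x∈p∪q⁻ ⁅ a ⁆ ⁅ b ⁆ x∈)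

∣⁅a⁆∪⁅b⁆∣≡2 : ∀ {n} {a b : Fin n} → a ≢ b → ∣ ⁅ a ⁆ ∪ ⁅ b ⁆ ∣ ≡ 2
∣⁅a⁆∪⁅b⁆∣≡2 {a = a} a≢b = trans (∣p∪⁅x⁆∣≡1+∣p∣ (a≢b ∘ sym ∘ x∈⁅y⁆⇒x≡y a)) (cong suc (∣⁅x⁆∣≡1 a))

∣p∣≡3 : ∀ {n} {p : Subset n} {a b c} → a ∈ p → b ∈ p → c ∈ p
      → (∀ {x} → x ∈ p → x ≡ a ⊎ x ≡ b ⊎ x ≡ c) → a ≢ b → a ≢ c → b ≢ c → ∣ p ∣ ≡ 3
∣p∣≡3 {p = p} {a} {b} {c} a∈p b∈p c∈p p⊆abc a≢b a≢c b≢c = begin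
  ∣ p ∣                      ≡⟨ cong ∣_∣ (⊆-antisym p⊆abc′ abc⊆p) ⟩
  ∣ (⁅ a ⁆ ∪ ⁅ b ⁆) ∪ ⁅ c ⁆ ∣  ≡⟨ ∣p∪⁅x⁆∣≡1+∣p∣ c∉ab ⟩
  suc ∣ ⁅ a ⁆ ∪ ⁅ b ⁆ ∣        ≡⟨ cong suc (∣⁅a⁆∪⁅b⁆∣≡2 a≢b) ⟩
  3                          ∎
  where
  open ≡-Reasoning
  c∉ab : c ∉ ⁅ a ⁆ ∪ ⁅ b ⁆
  c∉ab c∈ = Sum.[ a≢c ∘ sym , b≢c ∘ sym ] (x∈⁅a⁆∪⁅b⁆⁻ c∈)
  p⊆abc′ : p ⊆ (⁅ a ⁆ ∪ ⁅ b ⁆) ∪ ⁅ c ⁆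
  p⊆abc′ x∈p with p⊆abc x∈p
  ... | inj₁ refl = p⊆p∪q ⁅ c ⁆ (p⊆p∪q ⁅ b ⁆ (x∈⁅x⁆ a))
  ... | inj₂ (inj₁ refl) = p⊆p∪q ⁅ c ⁆ (q⊆p∪q ⁅ a ⁆ ⁅ b ⁆ (x∈⁅x⁆ b))
  ... | inj₂ (inj₂ refl) = q⊆p∪q (⁅ a ⁆ ∪ ⁅ b ⁆) ⁅ c ⁆ (x∈⁅x⁆ c)
  abc⊆p : (⁅ a ⁆ ∪ ⁅ b ⁆) ∪ ⁅ c ⁆ ⊆ p
  abc⊆p x∈ with x∈p∪q⁻ (⁅ a ⁆ ∪ ⁅ b ⁆) ⁅ c ⁆ x∈
  ... | inj₂ x∈c rewrite x∈⁅y⁆⇒x≡y c x∈c = c∈p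
  ... | inj₁ x∈ab with x∈⁅a⁆∪⁅b⁆⁻ x∈ab
  ...   | inj₁ refl = a∈p
  ...   | inj₂ refl = b∈p

-- Well-covered and vertex decomposable induced subgraphs

module GraphProperties {n : ℕ} (G : Graph n) where

  Edge : Fin n → Fin n → Set
  Edge u v = adj G u v ≡ true

  private
    variable
      u v w : Fin n
      W I : Subset n

  edge-sym : Edge u v → Edge v u
  edge-sym {u} {v} e = trans (Graph.sym G v u) e

  edge⇒≢ : Edge u v → u ≢ v
  edge⇒≢ {u} e refl = contradiction (trans (sym e) (irrefl G u)) λ ()

  ∈-delete⁻ : u ∈ delete G W w → u ∈ W × u ≢ w
  ∈-delete⁻ {W = W} {w} u∈ = p─q⊆p W ⁅ w ⁆ u∈ , x∉⁅y⁆⇒x≢y (x∈p─q⇒x∉q u∈)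

  ∈-delete⁺ : u ∈ W → u ≢ w → u ∈ delete G W w
  ∈-delete⁺ = x∈p∧x≢y⇒x∈p-y

  ∈-closedNbhd⁻ : u ∈ closedNbhd G w → u ≡ w ⊎ Edge w u
  ∈-closedNbhd⁻ {u} {w} u∈ with u ≟ w | trans (sym (lookup∘tabulate _ u)) ([]=⇒lookup u∈)
  ... | yes u≡w | _ = inj₁ u≡w
  ... | no _    | e = inj₂ e

  ∈-closedNbhd⁺ : u ≡ w ⊎ Edge w u → u ∈ closedNbhd G w
  ∈-closedNbhd⁺ {u} {w} h = lookup⇒[]= u _ (trans (lookup∘tabulate _ u) (lookup-true (u ≟ w) h))
    where
    lookup-true : (d : Dec (u ≡ w)) → u ≡ w ⊎ Edge w u → (does d ∨ adj G w u) ≡ true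
    lookup-true (yes _) _ = refl
    lookup-true (no u≢w) (inj₁ u≡w) = contradiction u≡w u≢w
    lookup-true (no _) (inj₂ e) = e

  ∈-deleteN⁻ : u ∈ deleteN G W w → u ∈ W × u ≢ w × adj G w u ≡ false
  ∈-deleteN⁻ {u} {W} {w} u∈ with x∈p∩q⁻ W _ u∈
  ... | u∈W , u∈∁N = u∈W , (u∉N ∘ ∈-closedNbhd⁺ ∘ inj₁) , Bool.¬-not (u∉N ∘ ∈-closedNbhd⁺ ∘ inj₂)
    where
    u∉N : u ∉ closedNbhd G w
    u∉N = x∈∁p⇒x∉p u∈∁N

  ∈-deleteN⁺ : u ∈ W → u ≢ w → adj G w u ≡ false → u ∈ deleteN G W w
  ∈-deleteN⁺ {u} {W} {w} u∈W u≢w w≁u = x∈p∩q⁺ (u∈W , x∉p⇒x∈∁p u∉N)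
    where
    u∉N : u ∉ closedNbhd G w
    u∉N u∈N with ∈-closedNbhd⁻ u∈N
    ... | inj₁ u≡w = u≢w u≡w
    ... | inj₂ e = contradiction (trans (sym e) w≁u) λ ()

  independent⇒¬edge : Independent G W I → u ∈ I → v ∈ I → ¬ Edge u v
  independent⇒¬edge {u = u} {v} (_ , indep) u∈I v∈I e = contradiction (trans (sym e) (indep u v u∈I v∈I)) λ ()

  independent-⁅⁆ : w ∈ W → Independent G W ⁅ w ⁆
  independent-⁅⁆ {w} w∈W = (λ u∈ → subst (_∈ _) (sym (x∈⁅y⁆⇒x≡y w u∈)) w∈W) , λ u v u∈ v∈ →
    subst₂ (λ u v → adj G u v ≡ false) (sym (x∈⁅y⁆⇒x≡y w u∈)) (sym (x∈⁅y⁆⇒x≡y w v∈)) (irrefl G w)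

  independent-∪⁅⁆ : Independent G W I → v ∈ W → (∀ {u} → u ∈ I → adj G u v ≡ false)
                  → Independent G W (I ∪ ⁅ v ⁆)
  independent-∪⁅⁆ {W} {I} {v} (I⊆W , indep) v∈W I≁v = I∪v⊆W , indep′
    where
    cases : ∀ {u} → u ∈ I ∪ ⁅ v ⁆ → u ∈ I ⊎ u ≡ v
    cases u∈ = Sum.map₂ (x∈⁅y⁆⇒x≡y v) (x∈p∪q⁻ I ⁅ v ⁆ u∈)
    I∪v⊆W : I ∪ ⁅ v ⁆ ⊆ W
    I∪v⊆W u∈ with cases u∈
    ... | inj₁ u∈I = I⊆W u∈I
    ... | inj₂ refl = v∈W
    indep′ : ∀ a b → a ∈ I ∪ ⁅ v ⁆ → b ∈ I ∪ ⁅ v ⁆ → adj G a b ≡ false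
    indep′ a b a∈ b∈ with cases a∈ | cases b∈
    ... | inj₁ a∈I | inj₁ b∈I = indep a b a∈I b∈I
    ... | inj₁ a∈I | inj₂ refl = I≁v a∈I
    ... | inj₂ refl | inj₁ b∈I = trans (Graph.sym G v b) (I≁v b∈I)
    ... | inj₂ refl | inj₂ refl = irrefl G v

  Dominates : Subset n → Subset n → Set
  Dominates I W = ∀ {v} → v ∈ W → v ∉ I → ∃[ u ] (u ∈ I × Edge u v)

  maximal⇒dominates : MaximalIndependent G W I → Dominates I W
  maximal⇒dominates {W} {I} (indI , maximal) {v} v∈W v∉I
    with any? (λ u → u ∈? I ×-dec (adj G u v Bool.≟ true))
  ... | yes found = found
  ... | no none = contradiction (maximal _ (independent-∪⁅⁆ indI v∈W I≁v) (p⊆p∪q ⁅ v ⁆) v∈I∪v) v∉I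
    where
    I≁v : ∀ {u} → u ∈ I → adj G u v ≡ false
    I≁v {u} u∈I = Bool.¬-not λ e → none (u , u∈I , e)
    v∈I∪v : v ∈ I ∪ ⁅ v ⁆
    v∈I∪v = q⊆p∪q I ⁅ v ⁆ (x∈⁅x⁆ v)

  dominates⇒maximal : Independent G W I → Dominates I W → MaximalIndependent G W I
  dominates⇒maximal {W} {I} indI dom = indI , maximal
    where
    maximal : ∀ J → Independent G W J → I ⊆ J → J ⊆ I
    maximal J indJ@(J⊆W , _) I⊆J {v} v∈J with v ∈? I
    ... | yes v∈I = v∈I
    ... | no v∉I with dom (J⊆W v∈J) v∉I
    ... | u , u∈I , e = contradiction e (independent⇒¬edge indJ (I⊆J u∈I) v∈J)

  maximal-∪⁅⁆ : w ∈ W → MaximalIndependent G (deleteN G W w) I → MaximalIndependent G W (I ∪ ⁅ w ⁆)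
  maximal-∪⁅⁆ {w} {W} {I} w∈W mI@((I⊆W∖N , _) , _) =
    dominates⇒maximal (independent-∪⁅⁆ indI w∈W I≁w) dom
    where
    indI : Independent G W I
    indI = proj₁ ∘ ∈-deleteN⁻ ∘ I⊆W∖N , proj₂ (proj₁ mI)
    I≁w : ∀ {u} → u ∈ I → adj G u w ≡ false
    I≁w {u} u∈I = trans (Graph.sym G u w) (proj₂ (proj₂ (∈-deleteN⁻ (I⊆W∖N u∈I))))
    dom : Dominates (I ∪ ⁅ w ⁆) W
    dom {v} v∈W v∉ with v ≟ w | adj G w v Bool.≟ true
    ... | yes refl | _ = contradiction (q⊆p∪q I ⁅ w ⁆ (x∈⁅x⁆ w)) v∉
    ... | no _ | yes e = w , q⊆p∪q I ⁅ w ⁆ (x∈⁅x⁆ w) , e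
    ... | no v≢w | no ¬e with maximal⇒dominates mI (∈-deleteN⁺ v∈W v≢w (Bool.¬-not ¬e)) (v∉ ∘ p⊆p∪q ⁅ w ⁆)
    ... | u , u∈I , e = u , p⊆p∪q ⁅ w ⁆ u∈I , e

  wellCovered-deleteN : WellCovered G W → w ∈ W → WellCovered G (deleteN G W w)
  wellCovered-deleteN {W} {w} wc w∈W I J mI mJ = ℕ.suc-injective (begin
    suc ∣ I ∣      ≡⟨ sym (∣p∪⁅x⁆∣≡1+∣p∣ (w∉ mI)) ⟩
    ∣ I ∪ ⁅ w ⁆ ∣  ≡⟨ wc _ _ (maximal-∪⁅⁆ w∈W mI) (maximal-∪⁅⁆ w∈W mJ) ⟩
    ∣ J ∪ ⁅ w ⁆ ∣  ≡⟨ ∣p∪⁅x⁆∣≡1+∣p∣ (w∉ mJ) ⟩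
    suc ∣ J ∣      ∎)
    where
    open ≡-Reasoning
    w∉ : ∀ {K} → MaximalIndependent G (deleteN G W w) K → w ∉ K
    w∉ ((K⊆ , _) , _) w∈K = proj₁ (proj₂ (∈-deleteN⁻ (K⊆ w∈K))) refl

  N[_]⊆N[_]in_ : Fin n → Fin n → Subset n → Set
  N[ v ]⊆N[ w ]in W = Edge v w × (∀ {u} → u ∈ W → u ≢ w → Edge v u → Edge w u)

  N[]⊆N[]-mono : ∀ {W′} → W′ ⊆ W → N[ v ]⊆N[ w ]in W → N[ v ]⊆N[ w ]in W′
  N[]⊆N[]-mono W′⊆W (v~w , N[v]⊆N[w]) = v~w , N[v]⊆N[w] ∘ W′⊆W

  maximal-delete : v ∈ W → N[ v ]⊆N[ w ]in W → MaximalIndependent G (delete G W w) I → MaximalIndependent G W I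
  maximal-delete {v} {W} {w} {I} v∈W (v~w , N[v]⊆N[w]) mI@((I⊆W-w , indep) , _) =
    dominates⇒maximal (proj₁ ∘ ∈-delete⁻ ∘ I⊆W-w , indep) dom
    where
    dom : Dominates I W
    dom {u} u∈W u∉I with u ≟ w | v ∈? I
    ... | no u≢w | _ = maximal⇒dominates mI (∈-delete⁺ u∈W u≢w) u∉I
    ... | yes refl | yes v∈I = v , v∈I , v~w
    ... | yes refl | no v∉I with maximal⇒dominates mI (∈-delete⁺ v∈W (edge⇒≢ v~w)) v∉I
    ... | a , a∈I , a~v with ∈-delete⁻ (I⊆W-w a∈I)
    ... | a∈W , a≢w = a , a∈I , edge-sym (N[v]⊆N[w] a∈W a≢w (edge-sym a~v))

  wellCovered-delete : WellCovered G W → v ∈ W → N[ v ]⊆N[ w ]in W → WellCovered G (delete G W w)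
  wellCovered-delete wc v∈W v⊑w I J mI mJ = wc I J (maximal-delete v∈W v⊑w mI) (maximal-delete v∈W v⊑w mJ)

  vd⇒wellCovered : VertexDecomposable G W → WellCovered G W
  vd⇒wellCovered (vd-noEdges wc _) = wc
  vd⇒wellCovered (vd-shed wc _ _ _ _) = wc

  vd-shed-dominating : WellCovered G W → v ∈ W → w ∈ W → N[ v ]⊆N[ w ]in W
    → (WellCovered G (delete G W w) → VertexDecomposable G (delete G W w))
    → (WellCovered G (deleteN G W w) → VertexDecomposable G (deleteN G W w))
    → VertexDecomposable G W
  vd-shed-dominating {W} {v} {w} wc v∈W w∈W v⊑w vd-delete vd-deleteN =
    vd-shed wc w w∈W (vd-delete (wellCovered-delete wc v∈W v⊑w)) (vd-deleteN (wellCovered-deleteN wc w∈W))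

  -- The vertices of D are shed one at a time; s is never shed and stays dominated by each of them.
  vd-shed-all-dominating : ∀ {s} (D : Fin n → Set) → Decidable D → s ∈ W
    → (∀ {w} → w ∈ W → D w → N[ s ]⊆N[ w ]in W)
    → (∀ {W′ w} → W′ ⊆ W → w ∈ W′ → D w
         → WellCovered G (deleteN G W′ w) → VertexDecomposable G (deleteN G W′ w))
    → (∀ {W′} → W′ ⊆ W → (∀ {u} → u ∈ W′ → ¬ D u) → WellCovered G W′ → VertexDecomposable G W′)
    → WellCovered G W → VertexDecomposable G W
  vd-shed-all-dominating {W} {s} D D? s∈W dominating vd-deleteN vd-rest =
    go (allFin n) (λ u∈W → u∈W) s∈W (λ {u} _ _ → ∈-allFin u)
    where
    go : ∀ ws {W′} → W′ ⊆ W → s ∈ W′ → (∀ {u} → u ∈ W′ → D u → u List.∈ ws)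
       → WellCovered G W′ → VertexDecomposable G W′
    go [] W′⊆W _ covered = vd-rest W′⊆W λ u∈ Du → case covered u∈ Du of λ ()
    go (w ∷ ws) {W′} W′⊆W s∈W′ covered wc with w ∈? W′ ×-dec D? w
    ... | yes (w∈W′ , Dw) =
      vd-shed-dominating wc s∈W′ w∈W′ (N[]⊆N[]-mono W′⊆W s⊑w)
        (go ws (W′⊆W ∘ proj₁ ∘ ∈-delete⁻) (∈-delete⁺ s∈W′ (edge⇒≢ (proj₁ s⊑w))) covered′)
        (vd-deleteN W′⊆W w∈W′ Dw)
      where
      s⊑w : N[ s ]⊆N[ w ]in W
      s⊑w = dominating (W′⊆W w∈W′) Dw
      covered′ : ∀ {u} → u ∈ delete G W′ w → D u → u List.∈ ws
      covered′ u∈ Du with ∈-delete⁻ u∈ | covered (proj₁ (∈-delete⁻ u∈)) Du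
      ... | _ , u≢w | here u≡w = contradiction u≡w u≢w
      ... | _ | there u∈ws = u∈ws
    ... | no ¬w∈W′×Dw = go ws W′⊆W s∈W′ covered′ wc
      where
      covered′ : ∀ {u} → u ∈ W′ → D u → u List.∈ ws
      covered′ u∈ Du with covered u∈ Du
      ... | here refl = contradiction (u∈ , Du) ¬w∈W′×Dw
      ... | there u∈ws = u∈ws

  Clique : (Fin n → Set) → Set
  Clique K = ∀ {u v} → K u → K v → u ≢ v → Edge u v

  vd-edges-in-clique : (K : Fin n → Set) → Decidable K → Clique K
    → (∀ {u v} → u ∈ W → v ∈ W → Edge u v → K u)
    → WellCovered G W → VertexDecomposable G W
  vd-edges-in-clique {W} K K? clique edge⇒K wc with any? (λ u → u ∈? W ×-dec K? u)
  ... | no none = vd-noEdges wc λ u v u∈W v∈W → Bool.¬-not λ e → none (u , u∈W , edge⇒K u∈W v∈W e)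
  ... | yes (s , s∈W , Ks) = vd-shed-all-dominating D D? s∈W dominating vd-deleteN vd-rest wc
    where
    D : Fin n → Set
    D u = K u × u ≢ s
    D? : Decidable D
    D? u = K? u ×-dec ¬? (u ≟ s)
    dominating : ∀ {w} → w ∈ W → D w → N[ s ]⊆N[ w ]in W
    dominating w∈W (Kw , w≢s) =
      clique Ks Kw (w≢s ∘ sym) ,
      λ u∈W u≢w s~u → clique Kw (edge⇒K u∈W s∈W (edge-sym s~u)) (u≢w ∘ sym)
    vd-deleteN : ∀ {W′ w} → W′ ⊆ W → w ∈ W′ → D w
               → WellCovered G (deleteN G W′ w) → VertexDecomposable G (deleteN G W′ w)
    vd-deleteN {W′} {w} W′⊆W _ (Kw , _) wc′ = vd-noEdges wc′ λ u v u∈ v∈ → Bool.¬-not λ u~v →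
      let u∈W′ , u≢w , w≁u = ∈-deleteN⁻ u∈
          Ku = edge⇒K (W′⊆W u∈W′) (W′⊆W (proj₁ (∈-deleteN⁻ v∈))) u~v
      in contradiction (trans (sym (clique Kw Ku (u≢w ∘ sym))) w≁u) λ ()
    vd-rest : ∀ {W′} → W′ ⊆ W → (∀ {u} → u ∈ W′ → ¬ D u) → WellCovered G W′ → VertexDecomposable G W′
    vd-rest {W′} W′⊆W no-D wc′ = vd-noEdges wc′ λ u v u∈ v∈ → Bool.¬-not λ u~v →
      edge⇒≢ u~v (trans (≡s u∈ v∈ u~v) (sym (≡s v∈ u∈ (edge-sym u~v))))
      where
      ≡s : ∀ {u v} → u ∈ W′ → v ∈ W′ → Edge u v → u ≡ s
      ≡s {u} u∈ v∈ u~v = decidable-stable (u ≟ s) λ u≢s → no-D u∈ (edge⇒K (W′⊆W u∈) (W′⊆W v∈) u~v , u≢s)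

-- The vertices of P_m

Side : Set
Side = Bool

pattern ₁ = true
pattern ₂ = false

-- X ₁ i and X ₂ i are x_{2i+1} and x_{2i+2}, the neighbours of y₁ and y₂ among the x's; junk is the
-- image of Defs' other, which no vertex of P_m has.
data Vertex : Set where
  X : Side → ℕ → Vertex
  Y Z : Side → Vertex
  Z₃ junk : Vertex

_==_ : Side → Side → Bool
₁ == t = t
₂ == t = not t

adjV : Vertex → Vertex → Bool
adjV (X _ i) (X _ j) = not (i ≡ᵇ j)
adjV (X s _) (Y t) = t == s
adjV (Y s) (X t _) = s == t
adjV (Y s) (Z t) = s == t
adjV (Z t) (Y s) = s == t
adjV (Z s) (Z t) = not (s == t)
adjV (Z _) Z₃ = true
adjV Z₃ (Z _) = true
adjV _ _ = false

fromKind : Kind → Vertex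
fromKind (xv a) = X (evenᵇ a) (a / 2)
fromKind y₁ = Y ₁
fromKind y₂ = Y ₂
fromKind z₁ = Z ₁
fromKind z₂ = Z ₂
fromKind Kind.z₃ = Z₃
fromKind other = junk

adjK≡adjV : ∀ k l → adjK k l ≡ adjV (fromKind k) (fromKind l)
adjK≡adjV (xv _) = λ { (xv _) → refl ; y₁ → refl ; y₂ → refl ; z₁ → refl ; z₂ → refl ; Kind.z₃ → refl ; other → refl }
adjK≡adjV y₁     = λ { (xv _) → refl ; y₁ → refl ; y₂ → refl ; z₁ → refl ; z₂ → refl ; Kind.z₃ → refl ; other → refl }
adjK≡adjV y₂     = λ { (xv _) → refl ; y₁ → refl ; y₂ → refl ; z₁ → refl ; z₂ → refl ; Kind.z₃ → refl ; other → refl }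
adjK≡adjV z₁     = λ { (xv _) → refl ; y₁ → refl ; y₂ → refl ; z₁ → refl ; z₂ → refl ; Kind.z₃ → refl ; other → refl }
adjK≡adjV z₂     = λ { (xv _) → refl ; y₁ → refl ; y₂ → refl ; z₁ → refl ; z₂ → refl ; Kind.z₃ → refl ; other → refl }
adjK≡adjV Kind.z₃ = λ { (xv _) → refl ; y₁ → refl ; y₂ → refl ; z₁ → refl ; z₂ → refl ; Kind.z₃ → refl ; other → refl }
adjK≡adjV other  = λ _ → refl

data Block : Set where
  side : Side → Block
  triangle void : Block

block : Vertex → Block
block (X s _) = side s
block (Y s) = side s
block (Z _) = triangle
block Z₃ = triangle
block junk = void

_≟ᴮ_ : (β γ : Block) → Dec (β ≡ γ)
side s ≟ᴮ side t = Dec.map′ (cong side) (λ { refl → refl }) (s Bool.≟ t)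
side _ ≟ᴮ triangle = no λ ()
side _ ≟ᴮ void = no λ ()
triangle ≟ᴮ side _ = no λ ()
triangle ≟ᴮ triangle = yes refl
triangle ≟ᴮ void = no λ ()
void ≟ᴮ side _ = no λ ()
void ≟ᴮ triangle = no λ ()
void ≟ᴮ void = yes refl

data XOrY (s : Side) : Vertex → Set where
  X∈ : ∀ {t i} → XOrY s (X t i)
  Y∈ : XOrY s (Y s)

==-refl : ∀ s → (s == s) ≡ true
==-refl ₁ = refl
==-refl ₂ = refl

==-≢ : ∀ {s t} → s ≢ t → (s == t) ≡ false
==-≢ {₁} {₁} s≢t = contradiction refl s≢t
==-≢ {₁} {₂} _ = refl
==-≢ {₂} {₁} _ = refl
==-≢ {₂} {₂} s≢t = contradiction refl s≢t

==⇒≡ : ∀ {s t} → (s == t) ≡ true → s ≡ t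
==⇒≡ {₁} {₁} _ = refl
==⇒≡ {₂} {₂} _ = refl

≡ᵇ-refl : ∀ i → (i ≡ᵇ i) ≡ true
≡ᵇ-refl i = dec-true (i ℕ.≟ i) refl

≡ᵇ-≢ : ∀ {i j} → i ≢ j → (i ≡ᵇ j) ≡ false
≡ᵇ-≢ {i} {j} = dec-false (i ℕ.≟ j)

X-injectiveʳ : ∀ {s t i j} → X s i ≡ X t j → i ≡ j
X-injectiveʳ refl = refl

X≢X-not : ∀ {s i j} → X s i ≢ X (not s) j
X≢X-not {₁} ()
X≢X-not {₂} ()

Z≢Z-not : ∀ {s} → Z s ≢ Z (not s)
Z≢Z-not {₁} ()
Z≢Z-not {₂} ()

X-X-edge : ∀ s t {i j} → i ≢ j → adjV (X s i) (X t j) ≡ true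
X-X-edge _ _ i≢j = cong not (≡ᵇ-≢ i≢j)

X-X-nonedge⇒≡ : ∀ s t {i j} → adjV (X s i) (X t j) ≡ false → i ≡ j
X-X-nonedge⇒≡ _ _ {i} {j} e = ℕ.≡ᵇ⇒≡ i j (subst T (sym (Bool.not-injective e)) _)

block-clique : ∀ {p q} → block p ≡ block q → p ≢ q → adjV p q ≡ true
block-clique {X s i} {X s j} refl p≢q = X-X-edge s s (p≢q ∘ cong (X s))
block-clique {X s _} {Y s} refl _ = ==-refl s
block-clique {Y s} {X s _} refl _ = ==-refl s
block-clique {Y s} {Y s} refl p≢q = contradiction refl p≢q
block-clique {Z s} {Z t} refl p≢q = cong not (==-≢ (p≢q ∘ cong Z))
block-clique {Z _} {Z₃} refl _ = refl
block-clique {Z₃} {Z _} refl _ = refl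
block-clique {Z₃} {Z₃} refl p≢q = contradiction refl p≢q
block-clique {junk} {junk} refl p≢q = contradiction refl p≢q

side-block : ∀ {s p} → block p ≡ side s → (∃[ i ] p ≡ X s i) ⊎ p ≡ Y s
side-block {p = X _ i} refl = inj₁ (i , refl)
side-block {p = Y _} refl = inj₂ refl

triangle-X-nonedge : ∀ {p t i} → block p ≡ triangle → adjV p (X t i) ≡ false
triangle-X-nonedge {Z _} _ = refl
triangle-X-nonedge {Z₃} _ = refl

neighbour-X : ∀ {s i p} → adjV p (X s i) ≡ true → block p ≡ side s ⊎ ∃[ j ] (p ≡ X (not s) j × j ≢ i)
neighbour-X {s} {i} {X t j} e with t Bool.≟ s
... | yes refl = inj₁ refl
... | no t≢s = inj₂ (j , cong (λ t → X t j) (Bool.¬-not t≢s) , j≢i)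
  where
  j≢i : j ≢ i
  j≢i refl = contradiction (trans (sym e) (cong not (≡ᵇ-refl j))) λ ()
neighbour-X {p = Y t} e = inj₁ (cong side (==⇒≡ e))

neighbour-Y : ∀ {s p} → adjV p (Y s) ≡ true → (∃[ i ] p ≡ X s i) ⊎ p ≡ Z s
neighbour-Y {s} {X t i} e = inj₁ (i , cong (λ t → X t i) (sym (==⇒≡ e)))
neighbour-Y {s} {Z t} e = inj₂ (cong Z (sym (==⇒≡ e)))

Z₃-neighbour : ∀ {p} → adjV Z₃ p ≡ true → ∃[ t ] p ≡ Z t
Z₃-neighbour {Z t} _ = t , refl

+<ᵇ-false : ∀ n j → (n + j <ᵇ n) ≡ false
+<ᵇ-false zero j = refl
+<ᵇ-false (suc n) j = +<ᵇ-false n j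

+≡ᵇ-self : ∀ n j → (n + j ≡ᵇ n) ≡ (j ≡ᵇ 0)
+≡ᵇ-self zero j = refl
+≡ᵇ-self (suc n) j = +≡ᵇ-self n j

+≡ᵇ+ : ∀ n i j → (n + i ≡ᵇ n + j) ≡ (i ≡ᵇ j)
+≡ᵇ+ zero i j = refl
+≡ᵇ+ (suc n) i j = +≡ᵇ+ n i j

kindAbove : ℕ → Kind
kindAbove 0 = y₁
kindAbove 1 = y₂
kindAbove 2 = z₁
kindAbove 3 = z₂
kindAbove 4 = Kind.z₃
kindAbove _ = other

kind-2m+ : ∀ m j → j < 5 → kind m (2 * m + j) ≡ kindAbove j
kind-2m+ m j _ rewrite +<ᵇ-false (2 * m) j | +≡ᵇ-self (2 * m) j with j
kind-2m+ m j _ | 0 = refl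
kind-2m+ m j _ | 1 rewrite +≡ᵇ+ (2 * m) 1 1 = refl
kind-2m+ m j _ | 2 rewrite +≡ᵇ+ (2 * m) 2 1 | +≡ᵇ+ (2 * m) 2 2 = refl
kind-2m+ m j _ | 3 rewrite +≡ᵇ+ (2 * m) 3 1 | +≡ᵇ+ (2 * m) 3 2 | +≡ᵇ+ (2 * m) 3 3 = refl
kind-2m+ m j _ | 4 rewrite +≡ᵇ+ (2 * m) 4 1 | +≡ᵇ+ (2 * m) 4 2 | +≡ᵇ+ (2 * m) 4 3 | +≡ᵇ+ (2 * m) 4 4 = refl
kind-2m+ m j (s≤s (s≤s (s≤s (s≤s (s≤s ()))))) | suc (suc (suc (suc (suc _))))

kind-<2m : ∀ m {k} → k < 2 * m → kind m k ≡ xv k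
kind-<2m m {k} k<2m with k <ᵇ 2 * m | ℕ.<⇒<ᵇ k<2m
... | true | _ = refl

even-*2 : ∀ i → evenᵇ (i * 2) ≡ true
even-*2 i = cong (_≡ᵇ 0) (m*n%n≡0 i 2)

odd-1+*2 : ∀ i → evenᵇ (suc (i * 2)) ≡ false
odd-1+*2 i = cong (_≡ᵇ 0) ([m+kn]%n≡m%n 1 i 2)

*2/2 : ∀ i → i * 2 / 2 ≡ i
*2/2 i = m*n/n≡m i 2

1+*2/2 : ∀ i → suc (i * 2) / 2 ≡ i
1+*2/2 i = trans (+-distrib-/ 1 (i * 2) (subst (λ r → 1 + r < 2) (sym (m*n%n≡0 i 2)) ℕ.≤-refl)) (*2/2 i)

/2-< : ∀ {k m} → k < 2 * m → k / 2 < m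
/2-< {k} {m} k<2m = m<n*o⇒m/o<n (subst (k <_) (ℕ.*-comm 2 m) k<2m)

odd-remainder : ∀ r → r < 2 → (r ≡ᵇ 0) ≡ false → r ≡ 1
odd-remainder 1 _ _ = refl
odd-remainder (suc (suc _)) (s≤s (s≤s ()))

module Encoding (m : ℕ) where

  N : ℕ
  N = 2 * m + 5

  view : Fin N → Vertex
  view u = fromKind (kind m (toℕ u))

  view-adj : ∀ {u v p q} → view u ≡ p → view v ≡ q → adj (P m) u v ≡ adjV p q
  view-adj {u} {v} refl refl = adjK≡adjV (kind m (toℕ u)) (kind m (toℕ v))

  Valid : Vertex → Set
  Valid (X _ i) = i < m
  Valid junk = ⊥
  Valid _ = Unit

  -- Y ₁ is coded as 2 * m + 0 so that every code past the x's has the shape 2 * m + j.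
  code : Vertex → ℕ
  code (X ₁ i) = i * 2
  code (X ₂ i) = suc (i * 2)
  code (Y ₁) = 2 * m + 0
  code (Y ₂) = 2 * m + 1
  code (Z ₁) = 2 * m + 2
  code (Z ₂) = 2 * m + 3
  code Z₃ = 2 * m + 4
  code junk = 2 * m + 5

  private
    decode-xv : ∀ k → k < 2 * m → Valid (fromKind (xv k)) × code (fromKind (xv k)) ≡ k
    decode-xv k k<2m with evenᵇ k in parity
    ... | ₁ = /2-< k<2m , sym (trans (m≡m%n+[m/n]*n k 2) (cong (_+ k / 2 * 2) k%2≡0))
      where
      k%2≡0 : k % 2 ≡ 0
      k%2≡0 = ℕ.≡ᵇ⇒≡ (k % 2) 0 (subst T (sym parity) _)
    ... | ₂ = /2-< k<2m , sym (trans (m≡m%n+[m/n]*n k 2) (cong (_+ k / 2 * 2) k%2≡1))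
      where
      k%2≡1 : k % 2 ≡ 1
      k%2≡1 = odd-remainder (k % 2) (m%n<n k 2) parity

    decode-above : ∀ j → j < 5
                 → Valid (fromKind (kind m (2 * m + j))) × code (fromKind (kind m (2 * m + j))) ≡ 2 * m + j
    decode-above j j<5 rewrite kind-2m+ m j j<5 with j
    ... | 0 = tt , refl
    ... | 1 = tt , refl
    ... | 2 = tt , refl
    ... | 3 = tt , refl
    ... | 4 = tt , refl
    decode-above j (s≤s (s≤s (s≤s (s≤s (s≤s ()))))) | suc (suc (suc (suc (suc _))))

    decode : ∀ k → k < N → Valid (fromKind (kind m k)) × code (fromKind (kind m k)) ≡ k
    decode k k<N with k ℕ.<? 2 * m
    ... | yes k<2m rewrite kind-<2m m k<2m = decode-xv k k<2m
    ... | no k≮2m = subst (λ k → Valid (fromKind (kind m k)) × code (fromKind (kind m k)) ≡ k) (ℕ.m+[n∸m]≡n 2m≤k)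
                      (decode-above (k ∸ 2 * m) k∸2m<5)
      where
      2m≤k : 2 * m ≤ k
      2m≤k = ℕ.≮⇒≥ k≮2m
      k∸2m<5 : k ∸ 2 * m < 5
      k∸2m<5 = subst (k ∸ 2 * m <_) (ℕ.m+n∸m≡n (2 * m) 5) (ℕ.∸-monoˡ-< k<N 2m≤k)

    *2<2* : ∀ {i} → i < m → i * 2 < 2 * m
    *2<2* {i} i<m = subst (i * 2 <_) (ℕ.*-comm m 2) (ℕ.*-monoˡ-< 2 i<m)

    1+*2<2* : ∀ {i} → i < m → suc (i * 2) < 2 * m
    1+*2<2* {i} i<m = subst (suc i * 2 ≤_) (ℕ.*-comm m 2) (ℕ.*-monoˡ-≤ 2 i<m)

    encode : ∀ p → Valid p → code p < N × fromKind (kind m (code p)) ≡ p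
    encode (X ₁ i) i<m rewrite kind-<2m m (*2<2* i<m) | even-*2 i | *2/2 i =
      ℕ.<-≤-trans (*2<2* i<m) (ℕ.m≤m+n (2 * m) 5) , refl
    encode (X ₂ i) i<m rewrite kind-<2m m (1+*2<2* i<m) | odd-1+*2 i | 1+*2/2 i =
      ℕ.<-≤-trans (1+*2<2* i<m) (ℕ.m≤m+n (2 * m) 5) , refl
    encode (Y ₁) _ rewrite kind-2m+ m 0 (s≤s z≤n) = ℕ.+-monoʳ-< (2 * m) (s≤s z≤n) , refl
    encode (Y ₂) _ rewrite kind-2m+ m 1 (s≤s (s≤s z≤n)) = ℕ.+-monoʳ-< (2 * m) (s≤s (s≤s z≤n)) , refl
    encode (Z ₁) _ rewrite kind-2m+ m 2 (s≤s (s≤s (s≤s z≤n))) = ℕ.+-monoʳ-< (2 * m) (s≤s (s≤s (s≤s z≤n))) , refl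
    encode (Z ₂) _ rewrite kind-2m+ m 3 (s≤s (s≤s (s≤s (s≤s z≤n)))) =
      ℕ.+-monoʳ-< (2 * m) (s≤s (s≤s (s≤s (s≤s z≤n)))) , refl
    encode Z₃ _ rewrite kind-2m+ m 4 ℕ.≤-refl = ℕ.+-monoʳ-< (2 * m) ℕ.≤-refl , refl

  view-valid : ∀ u → Valid (view u)
  view-valid u = proj₁ (decode (toℕ u) (toℕ<n u))

  view-injective : ∀ {u v} → view u ≡ view v → u ≡ v
  view-injective {u} {v} eq = toℕ-injective (begin
    toℕ u          ≡⟨ sym (proj₂ (decode (toℕ u) (toℕ<n u))) ⟩
    code (view u)  ≡⟨ cong code eq ⟩
    code (view v)  ≡⟨ proj₂ (decode (toℕ v) (toℕ<n v)) ⟩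
    toℕ v          ∎)
    where open ≡-Reasoning

  vertex : (p : Vertex) → Valid p → Fin N
  vertex p valid = fromℕ< (proj₁ (encode p valid))

  view-vertex : ∀ p valid → view (vertex p valid) ≡ p
  view-vertex p valid rewrite toℕ-fromℕ< (proj₁ (encode p valid)) = proj₂ (encode p valid)

  ≡vertex : ∀ {u p} valid → view u ≡ p → u ≡ vertex p valid
  ≡vertex valid eq = view-injective (trans eq (sym (view-vertex _ valid)))

  view-≢ : ∀ {u v p q} → view u ≡ p → view v ≡ q → p ≢ q → u ≢ v
  view-≢ eu ev p≢q refl = p≢q (trans (sym eu) ev)


module _ (m : ℕ) where

  open Encoding m
  open GraphProperties (P m)

  WC VD : Subset N → Set
  WC = WellCovered (P m)
  VD = VertexDecomposable (P m)

  x : Side → ∀ i → i < m → Fin N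
  x s i = vertex (X s i)

  y z : Side → Fin N
  y s = vertex (Y s) tt
  z s = vertex (Z s) tt

  z₃ : Fin N
  z₃ = vertex Z₃ tt

  view-x : ∀ s i (i<m : i < m) → view (x s i i<m) ≡ X s i
  view-x s i = view-vertex (X s i)

  view-y : ∀ s → view (y s) ≡ Y s
  view-y s = view-vertex (Y s) tt

  view-z : ∀ s → view (z s) ≡ Z s
  view-z s = view-vertex (Z s) tt

  view-z₃ : view z₃ ≡ Z₃
  view-z₃ = view-vertex Z₃ tt

  edge⇒adjV : ∀ {u v p q} → view u ≡ p → view v ≡ q → Edge u v → adjV p q ≡ true
  edge⇒adjV eu ev e = trans (sym (view-adj eu ev)) e

  adjV⇒edge : ∀ {u v p q} → view u ≡ p → view v ≡ q → adjV p q ≡ true → Edge u v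
  adjV⇒edge eu ev e = trans (view-adj eu ev) e

  -- Well-coveredness of P_m

  block-cover : ∀ {p} → Valid p → block p ≡ side ₁ ⊎ block p ≡ side ₂ ⊎ block p ≡ triangle
  block-cover {X ₁ _} _ = inj₁ refl
  block-cover {X ₂ _} _ = inj₂ (inj₁ refl)
  block-cover {Y ₁} _ = inj₁ refl
  block-cover {Y ₂} _ = inj₂ (inj₁ refl)
  block-cover {Z _} _ = inj₂ (inj₂ refl)
  block-cover {Z₃} _ = inj₂ (inj₂ refl)

  block-unique : ∀ {W I a b} → Independent (P m) W I → a ∈ I → b ∈ I → block (view a) ≡ block (view b) → a ≡ b
  block-unique {a = a} {b} indI a∈I b∈I same = decidable-stable (a ≟ b) λ a≢b →
    independent⇒¬edge indI a∈I b∈I (adjV⇒edge refl refl (block-clique same (a≢b ∘ view-injective)))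

  Meets : Subset N → Block → Set
  Meets I β = ∃[ a ] (a ∈ I × block (view a) ≡ β)

  module _ {I : Subset N} (mI : MaximalIndependent (P m) ⊤ I) where

    meets-triangle : Meets I triangle
    meets-triangle with z₃ ∈? I
    ... | yes z₃∈I = z₃ , z₃∈I , cong block view-z₃
    ... | no z₃∉I with maximal⇒dominates mI ∈⊤ z₃∉I
    ... | u , u∈I , u~z₃ with Z₃-neighbour (edge⇒adjV view-z₃ refl (edge-sym u~z₃))
    ... | _ , eu = u , u∈I , cong block eu

    probe-x : ∀ s j (j<m : j < m) → Meets I (side s) ⊎ ∃[ u ] ∃[ k ] (u ∈ I × view u ≡ X (not s) k × k ≢ j)
    probe-x s j j<m with x s j j<m ∈? I
    ... | yes x∈I = inj₁ (_ , x∈I , cong block (view-x s j j<m))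
    ... | no x∉I with maximal⇒dominates mI ∈⊤ x∉I
    ... | u , u∈I , u~x with neighbour-X (edge⇒adjV refl (view-x s j j<m) u~x)
    ...   | inj₁ same = inj₁ (u , u∈I , same)
    ...   | inj₂ (k , eu , k≢j) = inj₂ (u , k , u∈I , eu , k≢j)

    meets-side : 0 < m → ∀ s → Meets I (side s)
    meets-side 0<m s with probe-x s 0 0<m
    ... | inj₁ meets = meets
    ... | inj₂ (u , k , u∈I , eu , _) with probe-x s k (subst Valid eu (view-valid u))
    ...   | inj₁ meets = meets
    ...   | inj₂ (w , l , w∈I , ew , l≢k) =
      contradiction (adjV⇒edge ew eu (X-X-edge (not s) (not s) l≢k)) (independent⇒¬edge (proj₁ mI) w∈I u∈I)

    maximal-size-3 : 0 < m → ∣ I ∣ ≡ 3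
    maximal-size-3 0<m with meets-side 0<m ₁ | meets-side 0<m ₂ | meets-triangle
    ... | a , a∈I , ba | b , b∈I , bb | c , c∈I , bc =
      ∣p∣≡3 a∈I b∈I c∈I one-of (distinct ba bb λ ()) (distinct ba bc λ ()) (distinct bb bc λ ())
      where
      distinct : ∀ {u v β γ} → block (view u) ≡ β → block (view v) ≡ γ → β ≢ γ → u ≢ v
      distinct bu bv β≢γ refl = β≢γ (trans (sym bu) bv)
      one-of : ∀ {u} → u ∈ I → u ≡ a ⊎ u ≡ b ⊎ u ≡ c
      one-of {u} u∈I with block-cover (view-valid u)
      ... | inj₁ bu = inj₁ (block-unique (proj₁ mI) u∈I a∈I (trans bu (sym ba)))
      ... | inj₂ (inj₁ bu) = inj₂ (inj₁ (block-unique (proj₁ mI) u∈I b∈I (trans bu (sym bb))))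
      ... | inj₂ (inj₂ bu) = inj₂ (inj₂ (block-unique (proj₁ mI) u∈I c∈I (trans bu (sym bc))))

  wellCovered-P : 0 < m → WC ⊤
  wellCovered-P 0<m I J mI mJ = trans (maximal-size-3 mI 0<m) (sym (maximal-size-3 mJ 0<m))

  -- Vertex decomposability of P_m

  AvoidsXZ : Side → Vertex → Set
  AvoidsXZ s p = (∀ i → p ≢ X s i) × (∀ t → p ≢ Z t)

  vd-avoiding-X-Z : ∀ s {W} → (∀ {u} → u ∈ W → AvoidsXZ s (view u)) → WC W → VD W
  vd-avoiding-X-Z s {W} avoids = vd-edges-in-clique K K? clique edge⇒K
    where
    K : Fin N → Set
    K u = block (view u) ≡ side (not s)
    K? : Decidable K
    K? u = block (view u) ≟ᴮ side (not s)
    clique : Clique K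
    clique Ku Kv u≢v = adjV⇒edge refl refl (block-clique (trans Ku (sym Kv)) (u≢v ∘ view-injective))
    edge⇒K : ∀ {u v} → u ∈ W → v ∈ W → Edge u v → K u
    edge⇒K {u} {v} u∈W v∈W u~v with view u in eu | avoids u∈W
    ... | X t i | noX , _ = cong side (Bool.¬-not λ t≡s → noX i (cong (λ t → X t i) t≡s))
    ... | Z t | _ , noZ = contradiction refl (noZ t)
    ... | junk | _ = contradiction (edge⇒adjV eu refl u~v) λ ()
    ... | Z₃ | _ with Z₃-neighbour (edge⇒adjV eu refl u~v)
    ...   | t , ev = contradiction ev (proj₂ (avoids v∈W) t)
    edge⇒K {u} {v} u∈W v∈W u~v | Y t | _ with t Bool.≟ s
    ...   | no t≢s = cong side (Bool.¬-not t≢s)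
    ...   | yes refl with neighbour-Y (edge⇒adjV refl eu (edge-sym u~v))
    ...     | inj₁ (i , ev) = contradiction ev (proj₁ (avoids v∈W) i)
    ...     | inj₂ ev = contradiction ev (proj₂ (avoids v∈W) s)

  vd-without-z₁z₂ : ∀ s {W} → y s ∈ W → (∀ {u} t → u ∈ W → view u ≢ Z t) → WC W → VD W
  vd-without-z₁z₂ s {W} y∈W noZ = vd-shed-all-dominating IsX IsX? y∈W dominating vd-deleteN vd-rest
    where
    IsX : Fin N → Set
    IsX u = ∃[ i ] view u ≡ X s i
    IsX? : Decidable IsX
    IsX? u with view u
    ... | X t i = Dec.map′ (λ { refl → i , refl }) (λ { (_ , refl) → refl }) (t Bool.≟ s)
    ... | Y _ = no λ ()
    ... | Z _ = no λ ()
    ... | Z₃ = no λ ()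
    ... | junk = no λ ()
    dominating : ∀ {w} → w ∈ W → IsX w → N[ y s ]⊆N[ w ]in W
    dominating {w} _ (i , ew) = adjV⇒edge (view-y s) ew (==-refl s) , y⊑w
      where
      y⊑w : ∀ {u} → u ∈ W → u ≢ w → Edge (y s) u → Edge w u
      y⊑w {u} u∈W u≢w y~u with neighbour-Y (edge⇒adjV refl (view-y s) (edge-sym y~u))
      ... | inj₁ (j , eu) =
        adjV⇒edge ew eu (X-X-edge s s {i} {j} λ { refl → u≢w (view-injective (trans eu (sym ew))) })
      ... | inj₂ eu = contradiction eu (noZ s u∈W)
    vd-deleteN : ∀ {W′ w} → W′ ⊆ W → w ∈ W′ → IsX w → WC (deleteN (P m) W′ w) → VD (deleteN (P m) W′ w)
    vd-deleteN {W′} {w} W′⊆W _ (i , ew) = vd-avoiding-X-Z s avoids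
      where
      avoids : ∀ {u} → u ∈ deleteN (P m) W′ w → AvoidsXZ s (view u)
      avoids {u} u∈ with ∈-deleteN⁻ u∈
      ... | u∈W′ , u≢w , w≁u = noX , λ t → noZ t (W′⊆W u∈W′)
        where
        noX : ∀ j → view u ≢ X s j
        noX j eu with X-X-nonedge⇒≡ s s {i} {j} (trans (sym (view-adj ew eu)) w≁u)
        ... | refl = u≢w (view-injective (trans eu (sym ew)))
    vd-rest : ∀ {W′} → W′ ⊆ W → (∀ {u} → u ∈ W′ → ¬ IsX u) → WC W′ → VD W′
    vd-rest W′⊆W noX = vd-avoiding-X-Z s λ u∈ → (λ i eu → noX u∈ (i , eu)) , λ t → noZ t (W′⊆W u∈)

  z₃⊑z : ∀ s {W} → N[ z₃ ]⊆N[ z s ]in W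
  z₃⊑z s = adjV⇒edge view-z₃ (view-z s) refl , z₃⊑z′
    where
    z₃⊑z′ : ∀ {u} → u ∈ _ → u ≢ z s → Edge z₃ u → Edge (z s) u
    z₃⊑z′ {u} _ u≢z z₃~u with Z₃-neighbour (edge⇒adjV view-z₃ refl z₃~u)
    ... | t , eu = adjV⇒edge (view-z s) eu (block-clique {Z s} {Z t} refl λ { refl → u≢z (≡vertex tt eu) })

  vertexDecomposable-P : 0 < m → VD ⊤
  vertexDecomposable-P 0<m = vd-shed-dominating (wellCovered-P 0<m) ∈⊤ ∈⊤ (z₃⊑z ₂) vd-⊤-z₂ vd-⊤∖N[z₂]
    where
    ≢z : ∀ {u s} → u ≢ z s → view u ≢ Z s
    ≢z u≢z eu = u≢z (≡vertex tt eu)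
    vd-⊤-z₂ : WC (⊤ - z ₂) → VD (⊤ - z ₂)
    vd-⊤-z₂ wc = vd-shed-dominating wc
      (∈-delete⁺ ∈⊤ (view-≢ view-z₃ (view-z ₂) λ ())) (∈-delete⁺ ∈⊤ (view-≢ (view-z ₁) (view-z ₂) λ ()))
      (z₃⊑z ₁) vd-⊤-z₂-z₁ vd-⊤-z₂∖N[z₁]
      where
      vd-⊤-z₂-z₁ : WC ((⊤ - z ₂) - z ₁) → VD ((⊤ - z ₂) - z ₁)
      vd-⊤-z₂-z₁ = vd-without-z₁z₂ ₁ y₁∈ noZ
        where
        y₁∈ : y ₁ ∈ (⊤ - z ₂) - z ₁
        y₁∈ = ∈-delete⁺ (∈-delete⁺ ∈⊤ (view-≢ (view-y ₁) (view-z ₂) λ ())) (view-≢ (view-y ₁) (view-z ₁) λ ())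
        noZ : ∀ {u} t → u ∈ (⊤ - z ₂) - z ₁ → view u ≢ Z t
        noZ ₁ u∈ = ≢z (proj₂ (∈-delete⁻ u∈))
        noZ ₂ u∈ = ≢z (proj₂ (∈-delete⁻ (proj₁ (∈-delete⁻ u∈))))
      vd-⊤-z₂∖N[z₁] : WC (deleteN (P m) (⊤ - z ₂) (z ₁)) → VD (deleteN (P m) (⊤ - z ₂) (z ₁))
      vd-⊤-z₂∖N[z₁] = vd-without-z₁z₂ ₂ y₂∈ noZ
        where
        y₂∈ : y ₂ ∈ deleteN (P m) (⊤ - z ₂) (z ₁)
        y₂∈ = ∈-deleteN⁺ (∈-delete⁺ ∈⊤ (view-≢ (view-y ₂) (view-z ₂) λ ())) (view-≢ (view-y ₂) (view-z ₁) λ ())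
                (view-adj (view-z ₁) (view-y ₂))
        noZ : ∀ {u} t → u ∈ deleteN (P m) (⊤ - z ₂) (z ₁) → view u ≢ Z t
        noZ ₁ u∈ = ≢z (proj₁ (proj₂ (∈-deleteN⁻ u∈)))
        noZ ₂ u∈ = ≢z (proj₂ (∈-delete⁻ (proj₁ (∈-deleteN⁻ u∈))))
    vd-⊤∖N[z₂] : WC (deleteN (P m) ⊤ (z ₂)) → VD (deleteN (P m) ⊤ (z ₂))
    vd-⊤∖N[z₂] = vd-without-z₁z₂ ₁ y₁∈ noZ
      where
      y₁∈ : y ₁ ∈ deleteN (P m) ⊤ (z ₂)
      y₁∈ = ∈-deleteN⁺ ∈⊤ (view-≢ (view-y ₁) (view-z ₂) λ ()) (view-adj (view-z ₂) (view-y ₁))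
      noZ : ∀ {u} t → u ∈ deleteN (P m) ⊤ (z ₂) → view u ≢ Z t
      noZ ₁ u∈ eu = contradiction (trans (sym (view-adj (view-z ₂) eu)) (proj₂ (proj₂ (∈-deleteN⁻ u∈)))) λ ()
      noZ ₂ u∈ = ≢z (proj₁ (proj₂ (∈-deleteN⁻ u∈)))

  -- Graphs that are not well-covered

  ∈N[x̄] : ∀ s j (j<m : j < m) {u} → XOrY (not s) (view u) → u ≢ x s j j<m
        → u ∈ closedNbhd (P m) (x (not s) j j<m)
  ∈N[x̄] s j j<m {u} xy u≢x with view u in eu | xy
  ... | .(Y (not s)) | Y∈ = ∈-closedNbhd⁺ (inj₂ (adjV⇒edge (view-x (not s) j j<m) eu (==-refl (not s))))
  ... | .(X t i) | X∈ {t} {i} with i ℕ.≟ j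
  ...   | no i≢j =
    ∈-closedNbhd⁺ (inj₂ (adjV⇒edge (view-x (not s) j j<m) eu (X-X-edge (not s) t {j} {i} (i≢j ∘ sym))))
  ...   | yes refl with t Bool.≟ s
  ...     | yes refl = contradiction (≡vertex j<m eu) u≢x
  ...     | no t≢s = ∈-closedNbhd⁺ (inj₁ (≡vertex j<m (trans eu (cong (λ t → X t j) (Bool.¬-not t≢s)))))

  another-index : 1 < m → ∀ j → ∃[ k ] (k < m × k ≢ j)
  another-index 1<m zero = 1 , 1<m , λ ()
  another-index 1<m (suc _) = 0 , ℕ.<⇒≤ 1<m , λ ()

  ¬wellCovered-between : 1 < m → ∀ s j (j<m : j < m) {W}
    → (∀ t i (i<m : i < m) → X t i ≢ X s j → x t i i<m ∈ W)
    → W ⊆ closedNbhd (P m) (x (not s) j j<m)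
    → ¬ WC W
  ¬wellCovered-between 1<m s j j<m {W} X∖x⊆W W⊆N[x̄] wc with another-index 1<m j
  ... | k , k<m , k≢j = contradiction (trans (sym (∣⁅x⁆∣≡1 x̄)) (trans (wc I J mI mJ) (∣⁅a⁆∪⁅b⁆∣≡2 a≢b))) λ ()
    where
    x̄ a b : Fin N
    x̄ = x (not s) j j<m
    a = x s k k<m
    b = x (not s) k k<m
    I J : Subset N
    I = ⁅ x̄ ⁆
    J = ⁅ a ⁆ ∪ ⁅ b ⁆
    a≢b : a ≢ b
    a≢b = view-≢ (view-x s k k<m) (view-x (not s) k k<m) X≢X-not
    mI : MaximalIndependent (P m) W I
    mI = dominates⇒maximal (independent-⁅⁆ (X∖x⊆W (not s) j j<m (X≢X-not ∘ sym))) dom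
      where
      dom : Dominates I W
      dom {v} v∈W v∉I with ∈-closedNbhd⁻ (W⊆N[x̄] v∈W)
      ... | inj₁ refl = contradiction (x∈⁅x⁆ x̄) v∉I
      ... | inj₂ x̄~v = x̄ , x∈⁅x⁆ x̄ , x̄~v
    mJ : MaximalIndependent (P m) W J
    mJ = dominates⇒maximal (independent-∪⁅⁆ (independent-⁅⁆ a∈W) b∈W a≁b) dom
      where
      a∈W : a ∈ W
      a∈W = X∖x⊆W s k k<m (k≢j ∘ X-injectiveʳ)
      b∈W : b ∈ W
      b∈W = X∖x⊆W (not s) k k<m (k≢j ∘ X-injectiveʳ)
      a≁b : ∀ {u} → u ∈ ⁅ a ⁆ → adj (P m) u b ≡ false
      a≁b {u} u∈ rewrite x∈⁅y⁆⇒x≡y a u∈ =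
        trans (view-adj (view-x s k k<m) (view-x (not s) k k<m)) (cong not (≡ᵇ-refl k))
      ∈J : ∀ {v q} → view v ≡ q → q ≡ X s k ⊎ q ≡ X (not s) k → v ∈ J
      ∈J ev (inj₁ refl) = p⊆p∪q ⁅ b ⁆ (subst (_∈ ⁅ a ⁆) (sym (≡vertex k<m ev)) (x∈⁅x⁆ a))
      ∈J ev (inj₂ refl) = q⊆p∪q ⁅ a ⁆ ⁅ b ⁆ (subst (_∈ ⁅ b ⁆) (sym (≡vertex k<m ev)) (x∈⁅x⁆ b))
      x̄-adj : ∀ {v p} → v ∈ W → view v ≡ p → (∀ {t i} → p ≢ X t i) → adjV (X (not s) j) p ≡ true
      x̄-adj v∈W ev notX with ∈-closedNbhd⁻ (W⊆N[x̄] v∈W)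
      ... | inj₁ refl = contradiction (trans (sym ev) (view-x (not s) j j<m)) notX
      ... | inj₂ x̄~v = edge⇒adjV (view-x (not s) j j<m) ev x̄~v
      dom : Dominates J W
      dom {v} v∈W v∉J with view v in ev
      ... | X t i with i ℕ.≟ k
      ...   | no i≢k =
        a , p⊆p∪q ⁅ b ⁆ (x∈⁅x⁆ a) , adjV⇒edge (view-x s k k<m) ev (X-X-edge s t {k} {i} (i≢k ∘ sym))
      ...   | yes refl with t Bool.≟ s
      ...     | yes refl = contradiction (∈J ev (inj₁ refl)) v∉J
      ...     | no t≢s = contradiction (∈J ev (inj₂ (cong (λ t → X t k) (Bool.¬-not t≢s)))) v∉J
      dom {v} v∈W v∉J | Y t =
        b , q⊆p∪q ⁅ a ⁆ ⁅ b ⁆ (x∈⁅x⁆ b) , adjV⇒edge (view-x (not s) k k<m) ev (x̄-adj v∈W ev λ ())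
      dom {v} v∈W v∉J | Z t = contradiction (x̄-adj v∈W ev λ ()) λ ()
      dom {v} v∈W v∉J | Z₃ = contradiction (x̄-adj v∈W ev λ ()) λ ()
      dom {v} v∈W v∉J | junk = contradiction (x̄-adj v∈W ev λ ()) λ ()

  -- Shedding vertices of P_m

  nonNeighbour-Z : ∀ {s p} → Valid p → p ≢ Z s → adjV (Z s) p ≡ false → XOrY (not s) p
  nonNeighbour-Z {s} {X _ _} _ _ _ = X∈
  nonNeighbour-Z {s} {Y t} _ _ z≁y with t Bool.≟ s
  ... | yes refl = contradiction (trans (sym z≁y) (==-refl t)) λ ()
  ... | no t≢s rewrite Bool.¬-not t≢s = Y∈
  nonNeighbour-Z {s} {Z t} _ p≢z z≁z = contradiction (cong Z (sym (==⇒≡ (Bool.not-injective z≁z)))) p≢z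

  ¬shed-x : 1 < m → ∀ s j (j<m : j < m) → ¬ Shed (P m) ⊤ (x s j j<m)
  ¬shed-x 1<m s j j<m (_ , vd-⊤-x , _) =
    ¬wellCovered-between 1<m s j j<m X∖x⊆W W⊆N[x̄] (wellCovered-deleteN (vd⇒wellCovered vd-⊤-x) z∈)
    where
    W : Subset N
    W = deleteN (P m) (⊤ - x s j j<m) (z s)
    z∈ : z s ∈ ⊤ - x s j j<m
    z∈ = ∈-delete⁺ ∈⊤ (view-≢ (view-z s) (view-x s j j<m) λ ())
    X∖x⊆W : ∀ t i (i<m : i < m) → X t i ≢ X s j → x t i i<m ∈ W
    X∖x⊆W t i i<m ne = ∈-deleteN⁺ (∈-delete⁺ ∈⊤ (view-≢ (view-x t i i<m) (view-x s j j<m) ne))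
                         (view-≢ (view-x t i i<m) (view-z s) λ ()) (view-adj (view-z s) (view-x t i i<m))
    W⊆N[x̄] : W ⊆ closedNbhd (P m) (x (not s) j j<m)
    W⊆N[x̄] {v} v∈W with ∈-deleteN⁻ v∈W
    ... | v∈⊤-x , v≢z , z≁v = ∈N[x̄] s j j<m
      (nonNeighbour-Z (view-valid v) (v≢z ∘ ≡vertex tt) (trans (sym (view-adj (view-z s) refl)) z≁v))
      (proj₂ (∈-delete⁻ v∈⊤-x))

  -- A shedding step from a trapped graph either deletes some x, which leaves a graph that is not
  -- well-covered, or leads to a trapped graph again.
  record Trapped (s : Side) (W : Subset N) : Set where
    field
      X⊆W : ∀ t i (i<m : i < m) → x t i i<m ∈ W
      y∉W : y s ∉ W
      y∈⇒z∈ : y (not s) ∈ W → z (not s) ∈ W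

  trapped-XOrY : ∀ {s W u} r → Trapped s W → u ∈ W → view u ≢ Y (not s) → block (view u) ≢ triangle
               → XOrY r (view u)
  trapped-XOrY {s} {W} {u} r trapped u∈W not-y not-triangle with view u in eu
  ... | X _ _ = X∈
  ... | Z _ = contradiction refl not-triangle
  ... | Z₃ = contradiction refl not-triangle
  ... | junk = contradiction (subst Valid eu (view-valid u)) λ ()
  ... | Y t with t Bool.≟ s
  ...   | yes refl = contradiction (subst (_∈ W) (≡vertex tt eu) u∈W) (Trapped.y∉W trapped)
  ...   | no t≢s = contradiction (cong Y (Bool.¬-not t≢s)) not-y

  -- Deleting N[c] for such a c removes all of {z₁, z₂, z₃, y (not s)} from W.
  Clearing : Side → Subset N → Fin N → Set
  Clearing s W c = c ∈ W × block (view c) ≡ triangle × (y (not s) ∈ W → Edge c (y (not s)))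

  clearing? : ∀ s W → Decidable (Clearing s W)
  clearing? s W c =
    c ∈? W ×-dec block (view c) ≟ᴮ triangle ×-dec (y (not s) ∈? W →-dec (adj (P m) c (y (not s)) Bool.≟ true))

  ¬wellCovered-trapped : 1 < m → ∀ {s W} → Trapped s W → ∀ t j (j<m : j < m) → ¬ WC (W - x t j j<m)
  ¬wellCovered-trapped 1<m {s} {W} trapped t j j<m wc with any? (clearing? s W)
  ... | yes (c , c∈W , bc , c~y) = ¬wellCovered-between 1<m t j j<m X∖x⊆W W⊆N[x̄] (wellCovered-deleteN wc c∈)
    where
    open Trapped trapped
    c≢X : ∀ t′ i (i<m : i < m) → c ≢ x t′ i i<m
    c≢X t′ i i<m refl = contradiction (trans (sym bc) (cong block (view-x t′ i i<m))) λ ()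
    c∈ : c ∈ W - x t j j<m
    c∈ = ∈-delete⁺ c∈W (c≢X t j j<m)
    X∖x⊆W : ∀ t′ i (i<m : i < m) → X t′ i ≢ X t j → x t′ i i<m ∈ deleteN (P m) (W - x t j j<m) c
    X∖x⊆W t′ i i<m ne = ∈-deleteN⁺ (∈-delete⁺ (X⊆W t′ i i<m) (view-≢ (view-x t′ i i<m) (view-x t j j<m) ne))
      (c≢X t′ i i<m ∘ sym) (trans (view-adj refl (view-x t′ i i<m)) (triangle-X-nonedge bc))
    W⊆N[x̄] : deleteN (P m) (W - x t j j<m) c ⊆ closedNbhd (P m) (x (not t) j j<m)
    W⊆N[x̄] {u} u∈ with ∈-deleteN⁻ u∈
    ... | u∈W-x , u≢c , c≁u =
      ∈N[x̄] t j j<m (trapped-XOrY (not t) trapped u∈W not-y not-triangle) (proj₂ (∈-delete⁻ u∈W-x))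
      where
      u∈W : u ∈ W
      u∈W = proj₁ (∈-delete⁻ u∈W-x)
      ¬c~u : ¬ Edge c u
      ¬c~u c~u = contradiction (trans (sym c~u) c≁u) λ ()
      not-y : view u ≢ Y (not s)
      not-y eu = ¬c~u (subst (Edge c) (sym (≡vertex tt eu)) (c~y (subst (_∈ W) (≡vertex tt eu) u∈W)))
      not-triangle : block (view u) ≢ triangle
      not-triangle bu =
        ¬c~u (adjV⇒edge refl refl (block-clique (trans bc (sym bu)) (u≢c ∘ sym ∘ view-injective)))
  ... | no none = ¬wellCovered-between 1<m t j j<m X∖x⊆W W⊆N[x̄] wc
    where
    open Trapped trapped
    y∉W′ : y (not s) ∉ W
    y∉W′ y∈W = none (z (not s) , y∈⇒z∈ y∈W , cong block (view-z (not s)) ,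
                     λ _ → adjV⇒edge (view-z (not s)) (view-y (not s)) (==-refl (not s)))
    X∖x⊆W : ∀ t′ i (i<m : i < m) → X t′ i ≢ X t j → x t′ i i<m ∈ W - x t j j<m
    X∖x⊆W t′ i i<m ne = ∈-delete⁺ (X⊆W t′ i i<m) (view-≢ (view-x t′ i i<m) (view-x t j j<m) ne)
    W⊆N[x̄] : W - x t j j<m ⊆ closedNbhd (P m) (x (not t) j j<m)
    W⊆N[x̄] {u} u∈ with ∈-delete⁻ u∈
    ... | u∈W , u≢x = ∈N[x̄] t j j<m (trapped-XOrY (not t) trapped u∈W not-y not-triangle) u≢x
      where
      not-y : view u ≢ Y (not s)
      not-y eu = y∉W′ (subst (_∈ W) (≡vertex tt eu) u∈W)
      not-triangle : block (view u) ≢ triangle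
      not-triangle bu = none (u , u∈W , bu , λ y∈W → contradiction y∈W y∉W′)

  trapped-delete : ∀ {s W v p} → Trapped s W → view v ≡ p → (∀ {t i} → p ≢ X t i) → p ≢ Z (not s)
                 → Trapped s (W - v)
  trapped-delete {s} {W} {v} trapped ev notX notZ = record
    { X⊆W = λ t i i<m → ∈-delete⁺ (X⊆W t i i<m) (view-≢ (view-x t i i<m) ev (notX ∘ sym))
    ; y∉W = y∉W ∘ proj₁ ∘ ∈-delete⁻
    ; y∈⇒z∈ = λ y∈ → ∈-delete⁺ (y∈⇒z∈ (proj₁ (∈-delete⁻ y∈))) (view-≢ (view-z (not s)) ev (notZ ∘ sym))
    }
    where open Trapped trapped

  trapped-deleteN : ∀ {s W v} → Trapped s W → view v ≡ Z (not s) → Trapped s (deleteN (P m) W v)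
  trapped-deleteN {s} {W} {v} trapped ev = record
    { X⊆W = λ t i i<m →
        ∈-deleteN⁺ (X⊆W t i i<m) (view-≢ (view-x t i i<m) ev λ ()) (view-adj ev (view-x t i i<m))
    ; y∉W = y∉W ∘ proj₁ ∘ ∈-deleteN⁻
    ; y∈⇒z∈ = λ y∈ → contradiction (trans (sym (proj₂ (proj₂ (∈-deleteN⁻ y∈))))
                                           (trans (view-adj ev (view-y (not s))) (==-refl (not s)))) λ ()
    }
    where open Trapped trapped

  ¬vd-trapped : 1 < m → ∀ {s W} → Trapped s W → ¬ VD W
  ¬vd-trapped 1<m {s} trapped (vd-noEdges _ noEdges) =
    contradiction
      (trans (sym (noEdges _ _ (X⊆W s 0 0<m) (X⊆W s 1 1<m))) (view-adj (view-x s 0 0<m) (view-x s 1 1<m))) λ ()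
    where
    open Trapped trapped
    0<m : 0 < m
    0<m = ℕ.<⇒≤ 1<m
  ¬vd-trapped 1<m {s} {W} trapped (vd-shed _ v v∈W vd-W-v vd-W∖N[v]) with view v in ev
  ... | X t i =
    ¬wellCovered-trapped 1<m trapped t i i<m (subst (λ v → WC (W - v)) (≡vertex i<m ev) (vd⇒wellCovered vd-W-v))
    where
    i<m : i < m
    i<m = subst Valid ev (view-valid v)
  ... | Y t with t Bool.≟ s
  ...   | yes refl = Trapped.y∉W trapped (subst (_∈ W) (≡vertex tt ev) v∈W)
  ...   | no _ = ¬vd-trapped 1<m (trapped-delete trapped ev (λ ()) λ ()) vd-W-v
  ¬vd-trapped 1<m {s} {W} trapped (vd-shed _ v v∈W vd-W-v vd-W∖N[v]) | Z t with t Bool.≟ s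
  ...   | yes refl = ¬vd-trapped 1<m (trapped-delete trapped ev (λ ()) Z≢Z-not) vd-W-v
  ...   | no t≢s = ¬vd-trapped 1<m (trapped-deleteN trapped (trans ev (cong Z (Bool.¬-not t≢s)))) vd-W∖N[v]
  ¬vd-trapped 1<m {s} {W} trapped (vd-shed _ v v∈W vd-W-v vd-W∖N[v]) | Z₃ =
    ¬vd-trapped 1<m (trapped-delete trapped ev (λ ()) λ ()) vd-W-v
  ¬vd-trapped 1<m {s} {W} trapped (vd-shed _ v v∈W vd-W-v vd-W∖N[v]) | junk = subst Valid ev (view-valid v)

  ¬shed-y : 1 < m → ∀ s → ¬ Shed (P m) ⊤ (y s)
  ¬shed-y 1<m s (_ , vd-⊤-y , _) = ¬vd-trapped 1<m trapped vd-⊤-y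
    where
    trapped : Trapped s (⊤ - y s)
    trapped = record
      { X⊆W = λ t i i<m → ∈-delete⁺ ∈⊤ (view-≢ (view-x t i i<m) (view-y s) λ ())
      ; y∉W = λ y∈ → proj₂ (∈-delete⁻ y∈) refl
      ; y∈⇒z∈ = λ _ → ∈-delete⁺ ∈⊤ (view-≢ (view-z (not s)) (view-y s) λ ())
      }

  ¬shed-X : 1 < m → ∀ {u t i} → view u ≡ X t i → ¬ Shed (P m) ⊤ u
  ¬shed-X 1<m {u} {t} {i} eu = subst (λ u → ¬ Shed (P m) ⊤ u) (sym (≡vertex i<m eu)) (¬shed-x 1<m t i i<m)
    where
    i<m : i < m
    i<m = subst Valid eu (view-valid u)

  ¬dominating-shed : 1 < m → ¬ Dominating (P m) ⊤ (Shed (P m) ⊤)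
  ¬dominating-shed 1<m dominating with dominating (x ₁ 0 (ℕ.<⇒≤ 1<m)) ∈⊤ (¬shed-x 1<m ₁ 0 (ℕ.<⇒≤ 1<m))
  ... | u , u-shed , _ , u~x₁ with neighbour-X (edge⇒adjV refl (view-x ₁ 0 (ℕ.<⇒≤ 1<m)) u~x₁)
  ...   | inj₂ (_ , eu , _) = ¬shed-X 1<m eu u-shed
  ...   | inj₁ bu with side-block bu
  ...     | inj₁ (_ , eu) = ¬shed-X 1<m eu u-shed
  ...     | inj₂ eu = ¬shed-y 1<m ₁ (subst (Shed (P m) ⊤) (≡vertex tt eu) u-shed)

corollary6p11 : (m : ℕ) → 2 ≤ m →
    VertexDecomposable (P m) ⊤ × ¬ Dominating (P m) ⊤ (Shed (P m) ⊤)
corollary6p11 m 2≤m = vertexDecomposable-P m (ℕ.<⇒≤ 2≤m) , ¬dominating-shed m 2≤m
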